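{- For every positive integer $M$ there exist a connected graph $G$ and a vertex $v\in V(G)$ that is not a cut vertex of $G$ such that $|\chi_d^t(G)-\chi_d^t(G-v)|\geq M$; that is, $|\chi_d^t(G)-\chi_d^t(G-v)|$ can be arbitrarily large.
   Context: All graphs are simple and finite. For a graph with no isolated vertex, a total dominator coloring (TD-coloring) is a proper vertex coloring in which every vertex is adjacent to every vertex of some color class (a class other than its own); $\chi_d^t$ denotes the minimum number of colors in such a coloring. $G-v$ is the graph obtained from $G$ by deleting $v$ and all edges incident to $v$. -}

module Defs where

open import Data.Nat using (ℕ; suc)
open import Data.Fin using (Fin; punchIn)
open import Data.Bool using (Bool; true; false)
open import Data.Product using (Σ; ∃; ∃-syntax; _×_; _,_)
open import Relation.Binary.PropositionalEquality using (_≡_; _≢_)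
open import Relation.Nullary using (¬_)

record Graph (n : ℕ) : Set where
  field
    adj    : Fin n → Fin n → Bool
    sym    : ∀ u w → adj u w ≡ adj w u
    irrefl : ∀ u → adj u u ≡ false
open Graph public

Adj : ∀ {n} → Graph n → Fin n → Fin n → Set
Adj G u w = adj G u w ≡ true

_-ᵥ_ : ∀ {m} → Graph (suc m) → Fin (suc m) → Graph m
G -ᵥ v = record
  { adj    = λ i j → adj G (punchIn v i) (punchIn v j)
  ; sym    = λ i j → sym G (punchIn v i) (punchIn v j)
  ; irrefl = λ i → irrefl G (punchIn v i)
  }

data Reach {n} (G : Graph n) : Fin n → Fin n → Set where
  here : ∀ {u} → Reach G u u
  step : ∀ {u w x} → Adj G u w → Reach G w x → Reach G u x

Connected : ∀ {n} → Graph n → Set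
Connected {n} G = ∀ (u w : Fin n) → Reach G u w

-- v is a cut vertex of G: deleting v disconnects two vertices (other than v)
-- that were connected in G, i.e. G - v has more components than G.
CutVertex : ∀ {m} → Graph (suc m) → Fin (suc m) → Set
CutVertex {m} G v =
  ∃[ i ] ∃[ j ] (Reach G (punchIn v i) (punchIn v j) × ¬ Reach (G -ᵥ v) i j)

NoIsolated : ∀ {n} → Graph n → Set
NoIsolated {n} G = ∀ (u : Fin n) → ∃[ w ] Adj G u w

Proper : ∀ {n k} → Graph n → (Fin n → Fin k) → Set
Proper {n} G c = ∀ (u w : Fin n) → Adj G u w → c u ≢ c w

IsTDColoring : ∀ {n k} → Graph n → (Fin n → Fin k) → Set
IsTDColoring {n} {k} G c =
  Proper G c ×
  (∀ (u : Fin n) → ∃[ j ] (j ≢ c u × (∃[ w ] c w ≡ j) ×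
                          (∀ (w : Fin n) → c w ≡ j → Adj G u w)))

HasTDColoring : ∀ {n} → Graph n → ℕ → Set
HasTDColoring {n} G k = Σ (Fin n → Fin k) (IsTDColoring G)

IsTDChromatic : ∀ {n} → Graph n → ℕ → Set
IsTDChromatic G k =
  HasTDColoring G k × (∀ (k' : ℕ) → HasTDColoring G k' → k Data.Nat.≤ k')

-- Let H be the corona of a star with t ≥ 2 vertices: a star K_{1,t-1} with a pendant
-- vertex attached to each of its t vertices.  A pendant vertex is adjacent only to its
-- support vertex, so in a TD-coloring every support vertex is alone in its color class;
-- these t singleton classes and the class of one pendant vertex give χ_d^t(H) = t + 1.
-- Let G be H plus a universal vertex v.  Then G - v = H is connected, so v is not a cut
-- vertex, while G has χ_d^t(G) = 3: v is dominated by everyone as the class {v}, v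
-- dominates every other class, and H is a tree, hence 2-colorable.
module Submission where

open import Defs hiding (sym)
open import Data.Nat using (ℕ; suc; _+_; _≤_; ∣_-_∣)
open import Data.Nat.Properties using (≤-refl)
open import Data.Fin using (Fin; zero; suc; splitAt; join; _≟_)
open import Data.Fin.Properties using (splitAt-join; join-splitAt; injective⇒≤; suc-injective)
open import Data.Product using (Σ; ∃; ∃-syntax; _×_; _,_; proj₁; proj₂)
open import Data.Sum using (_⊎_; inj₁; inj₂)
open import Data.Sum.Properties using (inj₁-injective)
open import Data.Bool using (Bool; true; false)
open import Data.Empty using (⊥-elim)
open import Data.Vec.Functional using ([]; _∷_)
open import Function using (_∘_)
open import Function.Definitions using (Injective)
open import Relation.Nullary using (¬_; yes; no; does; contradiction)
open import Relation.Nullary.Decidable using (dec-true)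
open import Relation.Binary.PropositionalEquality

module _ {n} {G : Graph n} where

  Adj-sym : ∀ {u w} → Adj G u w → Adj G w u
  Adj-sym {u} {w} e = trans (Graph.sym G w u) e

  Reach-trans : ∀ {u w x} → Reach G u w → Reach G w x → Reach G u x
  Reach-trans here q = q
  Reach-trans (step e p) q = step e (Reach-trans p q)

  Reach-sym : ∀ {u w} → Reach G u w → Reach G w u
  Reach-sym here = here
  Reach-sym (step e p) = Reach-trans (Reach-sym p) (step (Adj-sym e) here)

  connected-by-hub : (h : Fin n) → (∀ u → Reach G u h) → Connected G
  connected-by-hub h toHub u w = Reach-trans (toHub u) (Reach-sym (toHub w))

  edge-clique : ∀ {a b} → Adj G a b → ∀ {i j} → i ≢ j →
                Adj G ((a ∷ b ∷ []) i) ((a ∷ b ∷ []) j)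
  edge-clique e {zero} {zero} ne = ⊥-elim (ne refl)
  edge-clique e {zero} {suc zero} _ = e
  edge-clique e {suc zero} {zero} _ = Adj-sym e
  edge-clique e {suc zero} {suc zero} ne = ⊥-elim (ne refl)

Dominates : ∀ {n k} → Graph n → (Fin n → Fin k) → Fin n → Set
Dominates {n} G c u =
  ∃[ j ] (j ≢ c u × (∃[ w ] c w ≡ j) × (∀ (w : Fin n) → c w ≡ j → Adj G u w))

SingletonClass : ∀ {n k} → (Fin n → Fin k) → Fin n → Set
SingletonClass c s = ∀ w → c w ≡ c s → w ≡ s

module _ {n k} {G : Graph n} {c : Fin n → Fin k} where

  dominates-singleton : ∀ {u s} → SingletonClass c s → Adj G u s → c s ≢ c u →
                        Dominates G c u
  dominates-singleton {u} {s} singleton adj ne =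
    c s , ne , (s , refl) , λ w e → subst (Adj G u) (sym (singleton w e)) adj

  support-singleton : ∀ {ℓ s} → Dominates G c ℓ → (∀ w → Adj G ℓ w → w ≡ s) →
                      SingletonClass c s
  support-singleton {s = s} (j , _ , (w₀ , w₀∈j) , dominated) unique w e =
    unique w (dominated w (trans e cs≡j))
    where
    cs≡j : c s ≡ j
    cs≡j = subst (λ z → c z ≡ j) (unique w₀ (dominated w₀ w₀∈j)) w₀∈j

  singleton-classes⇒≤ : ∀ {t} (f : Fin t → Fin n) → Injective _≡_ _≡_ f →
                        (∀ i → SingletonClass c (f i)) →
                        (u : Fin n) → (∀ i → u ≢ f i) → suc t ≤ k
  singleton-classes⇒≤ {t} f f-injective singleton u u∉f = injective⇒≤ g-injective
    where
    g : Fin (suc t) → Fin k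
    g zero = c u
    g (suc i) = c (f i)

    g-injective : Injective _≡_ _≡_ g
    g-injective {zero} {zero} _ = refl
    g-injective {zero} {suc j} e = ⊥-elim (u∉f j (singleton j u e))
    g-injective {suc i} {zero} e = ⊥-elim (u∉f i (singleton i u (sym e)))
    g-injective {suc i} {suc j} e = cong suc (f-injective (singleton j (f i) e))

  clique⇒≤ : ∀ {m} (f : Fin m → Fin n) → (∀ {i j} → i ≢ j → Adj G (f i) (f j)) →
             Proper G c → m ≤ k
  clique⇒≤ f clique proper = injective⇒≤ colors-distinct
    where
    colors-distinct : Injective _≡_ _≡_ (c ∘ f)
    colors-distinct {i} {j} e with i ≟ j
    ... | yes i≡j = i≡j
    ... | no i≢j = contradiction e (proper (f i) (f j) (clique i≢j))

cone : ∀ {n} → Graph n → Graph (suc n)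
cone {n} H = record { adj = adjᶜ ; sym = symᶜ ; irrefl = irreflᶜ }
  where
  adjᶜ : Fin (suc n) → Fin (suc n) → Bool
  adjᶜ zero zero = false
  adjᶜ zero (suc _) = true
  adjᶜ (suc _) zero = true
  adjᶜ (suc x) (suc y) = adj H x y

  symᶜ : ∀ u w → adjᶜ u w ≡ adjᶜ w u
  symᶜ zero zero = refl
  symᶜ zero (suc _) = refl
  symᶜ (suc _) zero = refl
  symᶜ (suc x) (suc y) = Graph.sym H x y

  irreflᶜ : ∀ u → adjᶜ u u ≡ false
  irreflᶜ zero = refl
  irreflᶜ (suc x) = irrefl H x

apex-coloring : ∀ {n} → (Fin n → Fin 2) → Fin (suc n) → Fin 3
apex-coloring c zero = zero
apex-coloring c (suc x) = suc (c x)

apex-singleton : ∀ {n} (c : Fin n → Fin 2) → SingletonClass (apex-coloring c) zero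
apex-singleton c zero _ = refl
apex-singleton c (suc _) ()

module _ {n} {H : Graph n} where

  cone-connected : Connected (cone H)
  cone-connected = connected-by-hub zero λ { zero → here ; (suc _) → step refl here }

  -- cone H -ᵥ zero is H up to η, so its walks are those of H.
  cone-apex-not-cut : Connected H → ¬ CutVertex (cone H) zero
  cone-apex-not-cut connected (i , j , _ , unreachable) = unreachable (connected i j)

  cone-clique : ∀ {m} {f : Fin m → Fin n} → (∀ {i j} → i ≢ j → Adj H (f i) (f j)) →
                ∀ {i j} → i ≢ j → Adj (cone H) ((zero ∷ suc ∘ f) i) ((zero ∷ suc ∘ f) j)
  cone-clique clique {zero} {zero} ne = ⊥-elim (ne refl)
  cone-clique clique {zero} {suc _} _ = refl
  cone-clique clique {suc _} {zero} _ = refl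
  cone-clique clique {suc _} {suc _} ne = clique (ne ∘ cong suc)

module _ {n} {H : Graph (suc n)} where

  cone-noIsolated : NoIsolated (cone H)
  cone-noIsolated zero = suc zero , refl
  cone-noIsolated (suc _) = zero , refl

  cone-TDColoring : ∀ {c} → Proper H c → IsTDColoring (cone H) (apex-coloring c)
  cone-TDColoring {c} proper = proper-cone , dominates
    where
    proper-cone : Proper (cone H) (apex-coloring c)
    proper-cone zero zero ()
    proper-cone zero (suc _) _ ()
    proper-cone (suc _) zero _ ()
    proper-cone (suc x) (suc y) e = proper x y e ∘ suc-injective

    dominates : ∀ u → Dominates (cone H) (apex-coloring c) u
    dominates zero = suc (c zero) , (λ ()) , (suc zero , refl) , apex-adj
      where
      apex-adj : ∀ w → apex-coloring c w ≡ suc (c zero) → Adj (cone H) zero w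
      apex-adj zero ()
      apex-adj (suc _) _ = refl
    dominates (suc x) = dominates-singleton {G = cone H} (apex-singleton c) refl λ ()

  cone-TDChromatic : ∀ {c} → Proper H c → NoIsolated H → IsTDChromatic (cone H) 3
  cone-TDChromatic {c} proper noIsolated =
    (apex-coloring c , cone-TDColoring proper) ,
    λ { k (c′ , proper′ , _) → clique⇒≤ {G = cone H} triangle (cone-clique edge) proper′ }
    where
    b : Fin (suc n)
    b = proj₁ (noIsolated zero)
    triangle : Fin 3 → Fin (suc (suc n))
    triangle = zero ∷ suc ∘ (zero ∷ b ∷ [])
    edge : ∀ {i j} → i ≢ j → Adj H ((zero ∷ b ∷ []) i) ((zero ∷ b ∷ []) j)
    edge = edge-clique {G = H} (proj₂ (noIsolated zero))

-- The corona of the star K_{1,t-1}, t = n + 2, on vertices labelled by Fin t ⊎ Fin t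
-- (numbered via join/splitAt); star zero is the centre of the star.
module StarCorona (n : ℕ) where

  t : ℕ
  t = suc (suc n)

  Label : Set
  Label = Fin t ⊎ Fin t

  pattern star i = inj₁ i
  pattern pendant i = inj₂ i

  label : Fin (t + t) → Label
  label = splitAt t

  vertex : Label → Fin (t + t)
  vertex = join t t

  label-vertex : ∀ a → label (vertex a) ≡ a
  label-vertex = splitAt-join t t

  vertex-label : ∀ x → vertex (label x) ≡ x
  vertex-label = join-splitAt t t

  vertex-injective : Injective _≡_ _≡_ vertex
  vertex-injective {a} {b} e = trans (sym (label-vertex a)) (trans (cong label e) (label-vertex b))

  label≡⇒≡vertex : ∀ {x a} → label x ≡ a → x ≡ vertex a
  label≡⇒≡vertex {x} e = trans (sym (vertex-label x)) (cong vertex e)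

  by-label : (P : Fin (t + t) → Set) → (∀ a → P (vertex a)) → ∀ x → P x
  by-label P p x = subst P (vertex-label x) (p (label x))

  adjˡ : Label → Label → Bool
  adjˡ (star i) (pendant j) = does (i ≟ j)
  adjˡ (pendant i) (star j) = does (j ≟ i)
  adjˡ (star zero) (star zero) = false
  adjˡ (star zero) (star (suc _)) = true
  adjˡ (star (suc _)) (star zero) = true
  adjˡ (star (suc _)) (star (suc _)) = false
  adjˡ (pendant _) (pendant _) = false

  adjˡ-sym : ∀ a b → adjˡ a b ≡ adjˡ b a
  adjˡ-sym (star zero) (star zero) = refl
  adjˡ-sym (star zero) (star (suc _)) = refl
  adjˡ-sym (star (suc _)) (star zero) = refl
  adjˡ-sym (star (suc _)) (star (suc _)) = refl
  adjˡ-sym (star _) (pendant _) = refl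
  adjˡ-sym (pendant _) (star _) = refl
  adjˡ-sym (pendant _) (pendant _) = refl

  adjˡ-irrefl : ∀ a → adjˡ a a ≡ false
  adjˡ-irrefl (star zero) = refl
  adjˡ-irrefl (star (suc _)) = refl
  adjˡ-irrefl (pendant _) = refl

  starCorona : Graph (t + t)
  starCorona = record
    { adj    = λ x y → adjˡ (label x) (label y)
    ; sym    = λ x y → adjˡ-sym (label x) (label y)
    ; irrefl = λ x → adjˡ-irrefl (label x)
    }

  adj-vertex : ∀ a b → adjˡ a b ≡ true → Adj starCorona (vertex a) (vertex b)
  adj-vertex a b e rewrite label-vertex a | label-vertex b = e

  pendant-support : ∀ i → adjˡ (pendant i) (star i) ≡ true
  pendant-support i = dec-true (i ≟ i) refl

  pendant-unique-neighbour : ∀ i b → adjˡ (pendant i) b ≡ true → b ≡ star i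
  pendant-unique-neighbour i (star j) e with j ≟ i
  ... | yes refl = refl
  pendant-unique-neighbour i (pendant _) ()

  partner : Label → Label
  partner (star i) = pendant i
  partner (pendant i) = star i

  partner-adj : ∀ a → adjˡ a (partner a) ≡ true
  partner-adj (star i) = pendant-support i
  partner-adj (pendant i) = pendant-support i

  starCorona-connected : Connected starCorona
  starCorona-connected = connected-by-hub (vertex (star zero)) (by-label _ to-centre)
    where
    star-to-centre : ∀ i → Reach starCorona (vertex (star i)) (vertex (star zero))
    star-to-centre zero = here
    star-to-centre (suc i) = step (adj-vertex (star (suc i)) (star zero) refl) here

    to-centre : ∀ a → Reach starCorona (vertex a) (vertex (star zero))
    to-centre (star i) = star-to-centre i
    to-centre (pendant i) =
      step (adj-vertex (pendant i) (star i) (pendant-support i)) (star-to-centre i)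

  starCorona-noIsolated : NoIsolated starCorona
  starCorona-noIsolated = by-label _ λ a → vertex (partner a) , adj-vertex a (partner a) (partner-adj a)

  side : Label → Fin 2
  side (star zero) = zero
  side (star (suc _)) = suc zero
  side (pendant zero) = suc zero
  side (pendant (suc _)) = zero

  side-proper : Proper starCorona (side ∘ label)
  side-proper x y = proper (label x) (label y)
    where
    proper : ∀ a b → adjˡ a b ≡ true → side a ≢ side b
    proper (star zero) (star zero) ()
    proper (star zero) (star (suc _)) _ ()
    proper (star (suc _)) (star zero) _ ()
    proper (star (suc _)) (star (suc _)) ()
    proper (star zero) (pendant zero) _ ()
    proper (star (suc _)) (pendant (suc _)) _ ()
    proper (pendant zero) (star zero) _ ()
    proper (pendant (suc _)) (star (suc _)) _ ()
    proper (pendant _) (pendant _) ()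

  colorˡ : Label → Fin (suc t)
  colorˡ (star i) = suc i
  colorˡ (pendant _) = zero

  color : Fin (t + t) → Fin (suc t)
  color = colorˡ ∘ label

  color-vertex : ∀ a → color (vertex a) ≡ colorˡ a
  color-vertex a = cong colorˡ (label-vertex a)

  color-proper : Proper starCorona color
  color-proper x y = proper (label x) (label y)
    where
    proper : ∀ a b → adjˡ a b ≡ true → colorˡ a ≢ colorˡ b
    proper (star zero) (star (suc _)) _ ()
    proper (star (suc _)) (star zero) _ ()
    proper (star _) (pendant _) _ ()
    proper (pendant _) (star _) _ ()

  star-singleton : ∀ i → SingletonClass color (vertex (star i))
  star-singleton i w e = label≡⇒≡vertex (star-class (label w) (trans e (color-vertex (star i))))
    where
    star-class : ∀ b → colorˡ b ≡ suc i → b ≡ star i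
    star-class (star _) refl = refl

  dominates-star : ∀ a i → adjˡ a (star i) ≡ true → colorˡ (star i) ≢ colorˡ a →
                   Dominates starCorona color (vertex a)
  dominates-star a i adj ne =
    dominates-singleton {G = starCorona} {c = color} {u = vertex a} (star-singleton i) (adj-vertex a (star i) adj)
      (subst₂ _≢_ (sym (color-vertex (star i))) (sym (color-vertex a)) ne)

  color-TD : IsTDColoring starCorona color
  color-TD = color-proper , by-label _ dominates
    where
    dominates : ∀ a → Dominates starCorona color (vertex a)
    dominates (star zero) = dominates-star (star zero) (suc zero) refl λ ()
    dominates (star (suc i)) = dominates-star (star (suc i)) zero refl λ ()
    dominates (pendant i) = dominates-star (pendant i) i (pendant-support i) λ ()

  pendant-leaf : ∀ i w → Adj starCorona (vertex (pendant i)) w → w ≡ vertex (star i)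
  pendant-leaf i w e rewrite label-vertex (pendant i) =
    label≡⇒≡vertex (pendant-unique-neighbour i (label w) e)

  starCorona-TDChromatic : IsTDChromatic starCorona (suc t)
  starCorona-TDChromatic = (color , color-TD) , lower-bound
    where
    lower-bound : ∀ k → HasTDColoring starCorona k → suc t ≤ k
    lower-bound k (c , _ , dominates) =
      singleton-classes⇒≤ {G = starCorona} {c = c} (vertex ∘ star) (inj₁-injective ∘ vertex-injective)
        (λ i → support-singleton {G = starCorona} (dominates (vertex (pendant i))) (pendant-leaf i))
        (vertex (pendant zero)) (λ i e → contradiction (vertex-injective {pendant zero} {star i} e) λ ())

theorem2p5 : ∀ (M : ℕ) → 1 ≤ M →
    ∃[ m ] Σ (Graph (suc m)) λ G → ∃[ v ] ∃[ k₁ ] ∃[ k₂ ]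
    (Connected G × ¬ CutVertex G v × NoIsolated G × NoIsolated (G -ᵥ v) ×
    IsTDChromatic G k₁ × IsTDChromatic (G -ᵥ v) k₂ × M ≤ ∣ k₁ - k₂ ∣)
theorem2p5 M _ =
  t + t , cone starCorona , zero , 3 , suc t ,
  cone-connected , cone-apex-not-cut starCorona-connected ,
  cone-noIsolated , starCorona-noIsolated ,
  cone-TDChromatic side-proper starCorona-noIsolated , starCorona-TDChromatic ,
  ≤-refl  -- ∣ 3 - (M + 3) ∣ reduces to M
  where open StarCorona M
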